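{- Let $X_1,X_2,Y$ be finite simplicial complexes such that $X_1$ $\mathrm{LC}$-reduces to its subcomplex $X_2$, and $Y$ has vertex set disjoint from that of $X_1$. Then $X_1*Y$ $\mathrm{LC}$-reduces to $X_2*Y$.
   Context: The join $X*Y$ of complexes on disjoint vertex sets is the complex whose faces are the sets $S\cup T$ with $S\in X$, $T\in Y$ (empty faces allowed). For a simplicial complex $\Delta$ with vertex set $V$, $\mathcal{F}(v)$ is the set of facets (maximal faces) containing $v$; for $\kappa\colon V\to[k]=\{1,\dots,k\}$ and a face $S$, $S_\kappa(t)=|\{v\in S:\kappa(v)=t\}|$; a $k$-linear coloring is a surjective $\kappa$ with $\sum_t\min(F_\kappa(t),F'_\kappa(t))=|F\cap F'|$ for all facets $F,F'$. A representative subcomplex w.r.t. $\kappa$ is the subcomplex $\{S\in\Delta:S\subseteq W\}$ induced on a set $W\subseteq V$ with exactly one vertex of each color such that $\mathcal{F}(x)\subseteq\mathcal{F}(y)$ whenever $x\in V$, $y\in W$, $\kappa(x)=\kappa(y)$. $\Delta$ $\mathrm{LC}$-reduces to $\Delta'$ if there is a sequence $\Delta=\Delta_0\supseteq\dots\supseteq\Delta_t=\Delta'$ with each $\Delta_{r+1}$ a representative subcomplex of $\Delta_r$ w.r.t. some linear coloring of $\Delta_r$. -}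

module Defs where

open import Data.Nat using (ℕ; _⊓_)
open import Data.Fin using (Fin)
import Data.Fin as F
open import Data.Fin.Subset using (Subset; _∈_; _⊆_; _∩_; _∪_; ∣_∣; ⁅_⁆)
open import Data.Vec using (tabulate; sum)
open import Data.Product using (Σ; ∃; ∃₂; _×_)
open import Data.Empty using () renaming (⊥ to Empty)
open import Relation.Nullary using (does)
open import Relation.Unary using (Pred; Decidable; _≐_)
open import Relation.Binary.PropositionalEquality using (_≡_)
open import Level using (0ℓ)

-- A (candidate) simplicial complex on the ambient finite vertex universe Fin n,
-- given by its family of faces (subsets of Fin n).
Cx : ℕ → Set₁
Cx n = Pred (Subset n) 0ℓ

IsComplex : ∀ {n} → Cx n → Set
IsComplex {n} Δ = Decidable Δ × (∀ (S T : Subset n) → Δ T → S ⊆ T → Δ S)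

_⊑_ : ∀ {n} → Cx n → Cx n → Set
Δ' ⊑ Δ = ∀ S → Δ' S → Δ S

Vert : ∀ {n} → Cx n → Fin n → Set
Vert Δ v = Δ ⁅ v ⁆

Join : ∀ {n} → Cx n → Cx n → Cx n
Join X Y S = ∃₂ λ A B → X A × Y B × S ≡ A ∪ B

IsFacet : ∀ {n} → Cx n → Subset n → Set
IsFacet {n} Δ F = Δ F × (∀ (G : Subset n) → Δ G → F ⊆ G → G ⊆ F)

colorClass : ∀ {n k} → (Fin n → Fin k) → Fin k → Subset n
colorClass κ t = tabulate (λ v → does (κ v F.≟ t))

count : ∀ {n k} → (Fin n → Fin k) → Subset n → Fin k → ℕ
count κ S t = ∣ S ∩ colorClass κ t ∣

-- k-linear coloring (κ is only relevant on the vertex set of Δ)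
IsLinearColoring : ∀ {n} (Δ : Cx n) (k : ℕ) → (Fin n → Fin k) → Set
IsLinearColoring {n} Δ k κ =
  (∀ (t : Fin k) → ∃ λ v → Vert Δ v × κ v ≡ t)
  × (∀ (A B : Subset n) → IsFacet Δ A → IsFacet Δ B →
       sum (tabulate (λ t → count κ A t ⊓ count κ B t)) ≡ ∣ A ∩ B ∣)

IsRepresentative : ∀ {n} (Δ : Cx n) (k : ℕ) → (Fin n → Fin k) → Cx n → Set
IsRepresentative {n} Δ k κ Δ' = ∃ λ (W : Subset n) →
  (∀ v → v ∈ W → Vert Δ v)
  × (∀ (t : Fin k) → ∃ λ v → v ∈ W × κ v ≡ t × (∀ u → u ∈ W → κ u ≡ t → u ≡ v))
  × (∀ x y → Vert Δ x → y ∈ W → κ x ≡ κ y →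
       ∀ (A : Subset n) → IsFacet Δ A → x ∈ A → y ∈ A)
  × (Δ' ≐ (λ S → Δ S × S ⊆ W))

LCStep : ∀ {n} → Cx n → Cx n → Set
LCStep Δ Δ' = ∃₂ λ k κ → IsLinearColoring Δ k κ × IsRepresentative Δ k κ Δ'

data LCReduces {n : ℕ} : Cx n → Cx n → Set₁ where
  done : ∀ {Δ Δ'} → Δ ≐ Δ' → LCReduces Δ Δ'
  step : ∀ {Δ Δ'} (Δ₁ : Cx n) → LCStep Δ Δ₁ → LCReduces Δ₁ Δ' → LCReduces Δ Δ'

DisjointVerts : ∀ {n} → Cx n → Cx n → Set
DisjointVerts X Y = ∀ v → Vert X v → Vert Y v → Empty

-- Every step X ⇝ X₁ of an LC-reduction lifts to a step X * Y ⇝ X₁ * Y.  Keep the colouring κ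
-- on X and give every vertex of Y a fresh colour of its own.  A facet of X * Y is A ∪ B with A a
-- facet of X, so the linearity sum splits into the old colours, where it is the linearity of κ
-- on A ∩ A′, and the new ones, whose colour classes are singletons and which count F ∩ F′ ∩ V(Y).
-- The representative set W of the step becomes W ∪ V(Y).  If X₁ or Y is the void complex
-- (no empty face), both joins are void.
module Submission where

open import Defs
open import Data.Bool using (Bool; true)
open import Data.Empty using (⊥-elim)
open import Data.Fin using (Fin; zero; suc; _↑ˡ_; _↑ʳ_; join; splitAt; _≟_)
open import Data.Fin.Properties using (splitAt-join; join-splitAt)
open import Data.Fin.Subset
  using (Subset; inside; outside; _∈_; _∉_; _⊆_; _∩_; _∪_; ∁; ∣_∣; ⁅_⁆; ⊥; Empty)
open import Data.Fin.Subset.Properties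
open import Data.Nat using (ℕ; zero; suc; _+_; _⊓_)
open import Data.Nat.Properties using (+-assoc; +-suc)
open import Data.Product using (_×_; _,_; proj₁; proj₂; ∃; ∃₂; map₁)
open import Data.Sum using (_⊎_; inj₁; inj₂)
import Data.Sum as Sum
open import Data.Vec using ([]; _∷_; here; there; tabulate; sum)
open import Data.Vec.Properties using (lookup∘tabulate; []=⇒lookup; lookup⇒[]=; tabulate-cong)
open import Data.Vec.Properties.WithK using ([]=-irrelevant)
open import Function using (_∘_; id)
open import Relation.Nullary using (yes; no; ¬_; does; _×-dec_)
open import Relation.Nullary.Decidable using (dec-true; dec-yes-irr; dec-no)
open import Relation.Unary using (Decidable; _≐_)
open import Relation.Binary.PropositionalEquality

nth : ∀ {n} (p : Subset n) → Fin ∣ p ∣ → Fin n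
nth (inside  ∷ p) zero    = zero
nth (inside  ∷ p) (suc j) = suc (nth p j)
nth (outside ∷ p) j       = suc (nth p j)

nth-∈ : ∀ {n} (p : Subset n) (j : Fin ∣ p ∣) → nth p j ∈ p
nth-∈ (inside  ∷ p) zero    = here
nth-∈ (inside  ∷ p) (suc j) = there (nth-∈ p j)
nth-∈ (outside ∷ p) j       = there (nth-∈ p j)

rank : ∀ {n} (p : Subset n) {x : Fin n} → x ∈ p → Fin ∣ p ∣
rank (inside  ∷ p) here        = zero
rank (inside  ∷ p) (there x∈p) = suc (rank p x∈p)
rank (outside ∷ p) (there x∈p) = rank p x∈p

nth-rank : ∀ {n} (p : Subset n) {x : Fin n} (x∈p : x ∈ p) → nth p (rank p x∈p) ≡ x
nth-rank (inside  ∷ p) here        = refl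
nth-rank (inside  ∷ p) (there x∈p) = cong suc (nth-rank p x∈p)
nth-rank (outside ∷ p) (there x∈p) = cong suc (nth-rank p x∈p)

rank-nth : ∀ {n} (p : Subset n) (j : Fin ∣ p ∣) → rank p (nth-∈ p j) ≡ j
rank-nth (inside  ∷ p) zero    = refl
rank-nth (inside  ∷ p) (suc j) = cong suc (rank-nth p j)
rank-nth (outside ∷ p) j       = rank-nth p j

x∈p∪q∧x∉q⇒x∈p : ∀ {n} {p q : Subset n} {x} → x ∈ p ∪ q → x ∉ q → x ∈ p
x∈p∪q∧x∉q⇒x∈p {p = p} {q} x∈p∪q x∉q = Sum.[ id , ⊥-elim ∘ x∉q ] (x∈p∪q⁻ p q x∈p∪q)

∩-∁-distrib : ∀ {n} (p q r : Subset n) → (p ∩ q) ∩ ∁ r ≡ (p ∩ ∁ r) ∩ (q ∩ ∁ r)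
∩-∁-distrib p q r = ⊆-antisym to from
  where
  to : (p ∩ q) ∩ ∁ r ⊆ (p ∩ ∁ r) ∩ (q ∩ ∁ r)
  to x∈ = let (x∈p∩q , x∈∁r) = x∈p∩q⁻ (p ∩ q) (∁ r) x∈
              (x∈p , x∈q)    = x∈p∩q⁻ p q x∈p∩q
          in  x∈p∩q⁺ (x∈p∩q⁺ (x∈p , x∈∁r) , x∈p∩q⁺ (x∈q , x∈∁r))
  from : (p ∩ ∁ r) ∩ (q ∩ ∁ r) ⊆ (p ∩ q) ∩ ∁ r
  from x∈ = let (x∈p∩∁r , x∈q∩∁r) = x∈p∩q⁻ (p ∩ ∁ r) (q ∩ ∁ r) x∈
                (x∈p , x∈∁r)      = x∈p∩q⁻ p (∁ r) x∈p∩∁r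
            in  x∈p∩q⁺ (x∈p∩q⁺ (x∈p , proj₁ (x∈p∩q⁻ q (∁ r) x∈q∩∁r)) , x∈∁r)

∣p∣≡∣p∩∁q∣+∣p∩q∣ : ∀ {n} (p q : Subset n) → ∣ p ∣ ≡ ∣ p ∩ ∁ q ∣ + ∣ p ∩ q ∣
∣p∣≡∣p∩∁q∣+∣p∩q∣ []            []            = refl
∣p∣≡∣p∩∁q∣+∣p∩q∣ (inside  ∷ p) (inside  ∷ q) = trans (cong suc (∣p∣≡∣p∩∁q∣+∣p∩q∣ p q)) (sym (+-suc _ _))
∣p∣≡∣p∩∁q∣+∣p∩q∣ (inside  ∷ p) (outside ∷ q) = cong suc (∣p∣≡∣p∩∁q∣+∣p∩q∣ p q)
∣p∣≡∣p∩∁q∣+∣p∩q∣ (outside ∷ p) (_       ∷ q) = ∣p∣≡∣p∩∁q∣+∣p∩q∣ p q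

∣p∩⁅x⁆∣≡1 : ∀ {n} {p : Subset n} {x} → x ∈ p → ∣ p ∩ ⁅ x ⁆ ∣ ≡ 1
∣p∩⁅x⁆∣≡1 {p = p} {x} x∈p = trans (cong ∣_∣ p∩⁅x⁆≡⁅x⁆) (∣⁅x⁆∣≡1 x)
  where
  p∩⁅x⁆≡⁅x⁆ : p ∩ ⁅ x ⁆ ≡ ⁅ x ⁆
  p∩⁅x⁆≡⁅x⁆ = ⊆-antisym (p∩q⊆q p ⁅ x ⁆) λ y∈⁅x⁆ →
    x∈p∩q⁺ (subst (_∈ p) (sym (x∈⁅y⁆⇒x≡y x y∈⁅x⁆)) x∈p , y∈⁅x⁆)

∣p∩⁅x⁆∣≡0 : ∀ {n} {p : Subset n} {x} → x ∉ p → ∣ p ∩ ⁅ x ⁆ ∣ ≡ 0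
∣p∩⁅x⁆∣≡0 {n} {p} {x} x∉p = trans (cong ∣_∣ (Empty-unique p∩⁅x⁆-empty)) (∣⊥∣≡0 n)
  where
  p∩⁅x⁆-empty : Empty (p ∩ ⁅ x ⁆)
  p∩⁅x⁆-empty (y , y∈) = let (y∈p , y∈⁅x⁆) = x∈p∩q⁻ p ⁅ x ⁆ y∈
                         in  x∉p (subst (_∈ p) (x∈⁅y⁆⇒x≡y x y∈⁅x⁆) y∈p)

∣p∩⁅x⁆∣⊓∣q∩⁅x⁆∣ : ∀ {n} (p q : Subset n) x → ∣ p ∩ ⁅ x ⁆ ∣ ⊓ ∣ q ∩ ⁅ x ⁆ ∣ ≡ ∣ (p ∩ q) ∩ ⁅ x ⁆ ∣
∣p∩⁅x⁆∣⊓∣q∩⁅x⁆∣ p q x with x ∈? p | x ∈? q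
... | yes x∈p | yes x∈q
  rewrite ∣p∩⁅x⁆∣≡1 x∈p | ∣p∩⁅x⁆∣≡1 x∈q | ∣p∩⁅x⁆∣≡1 (x∈p∩q⁺ (x∈p , x∈q)) = refl
... | yes x∈p | no x∉q
  rewrite ∣p∩⁅x⁆∣≡1 x∈p | ∣p∩⁅x⁆∣≡0 x∉q | ∣p∩⁅x⁆∣≡0 (x∉q ∘ proj₂ ∘ x∈p∩q⁻ p q) = refl
... | no x∉p | _
  rewrite ∣p∩⁅x⁆∣≡0 x∉p | ∣p∩⁅x⁆∣≡0 (x∉p ∘ proj₁ ∘ x∈p∩q⁻ p q) = refl

∣p∩q∣≡∑∣p∩⁅nth⁆∣ : ∀ {n} (p q : Subset n) → ∣ p ∩ q ∣ ≡ sum (tabulate (λ j → ∣ p ∩ ⁅ nth q j ⁆ ∣))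
∣p∩q∣≡∑∣p∩⁅nth⁆∣ []            []            = refl
∣p∩q∣≡∑∣p∩⁅nth⁆∣ {suc n} (inside  ∷ p) (inside  ∷ q)
  rewrite ∩-zeroʳ p | ∣⊥∣≡0 n = cong suc (∣p∩q∣≡∑∣p∩⁅nth⁆∣ p q)
∣p∩q∣≡∑∣p∩⁅nth⁆∣ {suc n} (outside ∷ p) (inside  ∷ q)
  rewrite ∩-zeroʳ p | ∣⊥∣≡0 n = ∣p∩q∣≡∑∣p∩⁅nth⁆∣ p q
∣p∩q∣≡∑∣p∩⁅nth⁆∣ (inside  ∷ p) (outside ∷ q) = ∣p∩q∣≡∑∣p∩⁅nth⁆∣ p q
∣p∩q∣≡∑∣p∩⁅nth⁆∣ (outside ∷ p) (outside ∷ q) = ∣p∩q∣≡∑∣p∩⁅nth⁆∣ p q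

∈-tabulate⁻ : ∀ {n} {b : Fin n → Bool} {v} → v ∈ tabulate b → b v ≡ true
∈-tabulate⁻ {b = b} {v} v∈ = trans (sym (lookup∘tabulate b v)) ([]=⇒lookup v∈)

∈-tabulate⁺ : ∀ {n} {b : Fin n → Bool} {v} → b v ≡ true → v ∈ tabulate b
∈-tabulate⁺ {b = b} {v} bv = lookup⇒[]= v (tabulate b) (trans (lookup∘tabulate b v) bv)

sum-tabulate-↑ : ∀ k {m} (f : Fin (k + m) → ℕ) →
  sum (tabulate f) ≡ sum (tabulate (f ∘ (_↑ˡ m))) + sum (tabulate (f ∘ (k ↑ʳ_)))
sum-tabulate-↑ zero    f = refl
sum-tabulate-↑ (suc k) f =
  trans (cong (f zero +_) (sum-tabulate-↑ k (f ∘ suc))) (sym (+-assoc (f zero) _ _))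

join-injective : ∀ k m {c d : Fin k ⊎ Fin m} → join k m c ≡ join k m d → c ≡ d
join-injective k m {c} {d} eq =
  trans (sym (splitAt-join k m c)) (trans (cong (splitAt k) eq) (splitAt-join k m d))

DownClosed : ∀ {n} → Cx n → Set
DownClosed {n} Δ = ∀ (S T : Subset n) → Δ T → S ⊆ T → Δ S

∈-face⇒Vert : ∀ {n} {Δ : Cx n} {S v} → DownClosed Δ → Δ S → v ∈ S → Vert Δ v
∈-face⇒Vert {S = S} {v} closed ΔS v∈S =
  closed ⁅ v ⁆ S ΔS λ x∈⁅v⁆ → subst (_∈ S) (sym (x∈⁅y⁆⇒x≡y v x∈⁅v⁆)) v∈S

vertices : ∀ {n} {Δ : Cx n} → Decidable Δ → Subset n
vertices Δ? = tabulate (λ v → does (Δ? ⁅ v ⁆))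

∈-vertices⁻ : ∀ {n} {Δ : Cx n} (Δ? : Decidable Δ) {v} → v ∈ vertices Δ? → Vert Δ v
∈-vertices⁻ Δ? {v} v∈ with Δ? ⁅ v ⁆ | ∈-tabulate⁻ v∈
... | yes Δv | _  = Δv
... | no _   | ()

∈-vertices⁺ : ∀ {n} {Δ : Cx n} (Δ? : Decidable Δ) {v} → Vert Δ v → v ∈ vertices Δ?
∈-vertices⁺ Δ? {v} Δv = ∈-tabulate⁺ (dec-true (Δ? ⁅ v ⁆) Δv)

∈-colorClass⁻ : ∀ {n k} (κ : Fin n → Fin k) {t v} → v ∈ colorClass κ t → κ v ≡ t
∈-colorClass⁻ κ {t} {v} v∈ with κ v ≟ t | ∈-tabulate⁻ v∈
... | yes κv≡t | _  = κv≡t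
... | no _     | ()

∈-colorClass⁺ : ∀ {n k} (κ : Fin n → Fin k) {t v} → κ v ≡ t → v ∈ colorClass κ t
∈-colorClass⁺ κ {t} {v} κv≡t = ∈-tabulate⁺ (dec-true (κ v ≟ t) κv≡t)

disjoint-faces : ∀ {n} {X Y : Cx n} {A B v} → DownClosed X → DownClosed Y → DisjointVerts X Y →
  X A → Y B → v ∈ A → v ∉ B
disjoint-faces {v = v} X-closed Y-closed disjoint XA YB v∈A v∈B =
  disjoint v (∈-face⇒Vert X-closed XA v∈A) (∈-face⇒Vert Y-closed YB v∈B)

DisjointVerts-⊑ : ∀ {n} {X X₁ Y : Cx n} → X₁ ⊑ X → DisjointVerts X Y → DisjointVerts X₁ Y
DisjointVerts-⊑ X₁⊑X disjoint v X₁v Yv = disjoint v (X₁⊑X _ X₁v) Yv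

Join-congˡ : ∀ {n} {X X′ Y : Cx n} → X ≐ X′ → Join X Y ≐ Join X′ Y
Join-congˡ (X⊆X′ , X′⊆X) = (λ (A , B , XA , YB , eq) → A , B , X⊆X′ XA , YB , eq)
                         , (λ (A , B , XA , YB , eq) → A , B , X′⊆X XA , YB , eq)

Join-∅ : ∀ {n} {X Y : Cx n} {S} → DownClosed X → DownClosed Y → Join X Y S → X ⊥ × Y ⊥
Join-∅ X-closed Y-closed (A , B , XA , YB , _) = X-closed ⊥ A XA (⊆-min A) , Y-closed ⊥ B YB (⊆-min B)

empty-≐ : ∀ {n} {P Q : Cx n} → (∀ {S} → ¬ P S) → (∀ {S} → ¬ Q S) → P ≐ Q
empty-≐ ¬P ¬Q = ⊥-elim ∘ ¬P , ⊥-elim ∘ ¬Q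

Join-Vertˡ : ∀ {n} {X Y : Cx n} {v} → Y ⊥ → Vert X v → Vert (Join X Y) v
Join-Vertˡ {v = v} Y∅ Xv = ⁅ v ⁆ , ⊥ , Xv , Y∅ , sym (∪-identityʳ ⁅ v ⁆)

Join-Vertʳ : ∀ {n} {X Y : Cx n} {v} → X ⊥ → Vert Y v → Vert (Join X Y) v
Join-Vertʳ {v = v} X∅ Yv = ⊥ , ⁅ v ⁆ , X∅ , Yv , sym (∪-identityˡ ⁅ v ⁆)

-- A bigger face G ⊇ A of X would make G ∪ B a face of the join above H = A ∪ B.
IsFacet-Join⁻ : ∀ {n} {X Y : Cx n} {H} → DownClosed X → DownClosed Y → DisjointVerts X Y →
  IsFacet (Join X Y) H → ∃₂ λ A B → IsFacet X A × Y B × H ≡ A ∪ B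
IsFacet-Join⁻ {X = X} {Y} X-closed Y-closed disjoint ((A , B , XA , YB , refl) , maximal) =
  A , B , (XA , maximalA) , YB , refl
  where
  maximalA : ∀ G → X G → A ⊆ G → G ⊆ A
  maximalA G XG A⊆G x∈G = x∈p∪q∧x∉q⇒x∈p (G∪B⊆A∪B (p⊆p∪q B x∈G))
                            (disjoint-faces X-closed Y-closed disjoint XG YB x∈G)
    where
    G∪B⊆A∪B : G ∪ B ⊆ A ∪ B
    G∪B⊆A∪B = maximal (G ∪ B) (G , B , XG , YB , refl)
                λ y∈ → x∈p∪q⁺ (Sum.map₁ A⊆G (x∈p∪q⁻ A B y∈))

representative-⊑ : ∀ {n k} {Δ Δ′ : Cx n} {κ : Fin n → Fin k} → IsRepresentative Δ k κ Δ′ → Δ′ ⊑ Δ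
representative-⊑ (_ , _ , _ , _ , Δ′⊆ , _) S Δ′S = proj₁ (Δ′⊆ Δ′S)

representative-closed : ∀ {n k} {Δ Δ′ : Cx n} {κ : Fin n → Fin k} →
  IsRepresentative Δ k κ Δ′ → DownClosed Δ → DownClosed Δ′
representative-closed (_ , _ , _ , _ , Δ′⊆ , ⊆Δ′) Δ-closed S T Δ′T S⊆T =
  let (ΔT , T⊆W) = Δ′⊆ Δ′T in ⊆Δ′ (Δ-closed S T ΔT S⊆T , T⊆W ∘ S⊆T)

representative-∅ : ∀ {n k} {Δ Δ′ : Cx n} {κ : Fin n → Fin k} →
  IsRepresentative Δ k κ Δ′ → Δ ⊥ → Δ′ ⊥
representative-∅ (W , _ , _ , _ , _ , ⊆Δ′) Δ∅ = ⊆Δ′ (Δ∅ , ⊆-min W)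

module _ {n} {Y : Cx n} (Y? : Decidable Y) (Y-closed : DownClosed Y) (Y∅ : Y ⊥) where

  private
    VY : Subset n
    VY = vertices Y?

    m : ℕ
    m = ∣ VY ∣

  module _ {X : Cx n} (X-closed : DownClosed X) (X∅ : X ⊥) (disjoint : DisjointVerts X Y) where

    private
      Vert-∉VY : ∀ {v} → Vert X v → v ∉ VY
      Vert-∉VY {v} Xv v∈VY = disjoint v Xv (∈-vertices⁻ Y? v∈VY)

      face-∉VY : ∀ {A v} → X A → v ∈ A → v ∉ VY
      face-∉VY XA = Vert-∉VY ∘ ∈-face⇒Vert X-closed XA

      face⊆VY : ∀ {B} → Y B → B ⊆ VY
      face⊆VY YB = ∈-vertices⁺ Y? ∘ ∈-face⇒Vert Y-closed YB

      Join-face-∩∁ : ∀ {A B} → X A → Y B → (A ∪ B) ∩ ∁ VY ≡ A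
      Join-face-∩∁ {A} {B} XA YB = ⊆-antisym
        (λ x∈ → let (x∈A∪B , x∈∁VY) = x∈p∩q⁻ (A ∪ B) (∁ VY) x∈
                in  x∈p∪q∧x∉q⇒x∈p x∈A∪B (x∈∁p⇒x∉p x∈∁VY ∘ face⊆VY YB))
        (λ x∈A → x∈p∩q⁺ (p⊆p∪q B x∈A , x∉p⇒x∈∁p (face-∉VY XA x∈A)))

      Join-face-∉VY : ∀ {A B x} → X A → Y B → x ∈ A ∪ B → x ∉ VY → x ∈ A
      Join-face-∉VY {A} {B} XA YB x∈A∪B x∉VY =
        subst (_ ∈_) (Join-face-∩∁ XA YB) (x∈p∩q⁺ (x∈A∪B , x∉p⇒x∈∁p x∉VY))

    module _ {k} (κ : Fin n → Fin k) where

      χ : Fin n → Fin k ⊎ Fin m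
      χ v with v ∈? VY
      ... | yes v∈VY = inj₂ (rank VY v∈VY)
      ... | no _     = inj₁ (κ v)

      κ⁺ : Fin n → Fin (k + m)
      κ⁺ = join k m ∘ χ

      private
        χ-∈ : ∀ {v} (v∈VY : v ∈ VY) → χ v ≡ inj₂ (rank VY v∈VY)
        χ-∈ {v} v∈VY rewrite dec-yes-irr (v ∈? VY) []=-irrelevant v∈VY = refl

        χ-∉ : ∀ {v} → v ∉ VY → χ v ≡ inj₁ (κ v)
        χ-∉ {v} v∉VY rewrite dec-no (v ∈? VY) v∉VY = refl

        χ-nth : ∀ j → χ (nth VY j) ≡ inj₂ j
        χ-nth j = trans (χ-∈ (nth-∈ VY j)) (cong inj₂ (rank-nth VY j))

        χ-inj₁ : ∀ {v t} → χ v ≡ inj₁ t → v ∉ VY × κ v ≡ t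
        χ-inj₁ {v} eq with v ∈? VY | eq
        ... | no v∉VY | refl = v∉VY , refl
        ... | yes _   | ()

        χ-inj₂ : ∀ {v j} → χ v ≡ inj₂ j → v ≡ nth VY j
        χ-inj₂ {v} eq with v ∈? VY | eq
        ... | yes v∈VY | refl = sym (nth-rank VY v∈VY)
        ... | no _     | ()

        ∩-colorClass-↑ˡ : ∀ H t → H ∩ colorClass κ⁺ (t ↑ˡ m) ≡ (H ∩ ∁ VY) ∩ colorClass κ t
        ∩-colorClass-↑ˡ H t = ⊆-antisym
          (λ x∈ → let (x∈H , x∈C) = x∈p∩q⁻ H _ x∈
                      (x∉VY , κx≡t) = χ-inj₁ (join-injective k m (∈-colorClass⁻ κ⁺ x∈C))
                  in  x∈p∩q⁺ (x∈p∩q⁺ (x∈H , x∉p⇒x∈∁p x∉VY) , ∈-colorClass⁺ κ κx≡t))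
          (λ x∈ → let (x∈H∩∁VY , x∈C) = x∈p∩q⁻ (H ∩ ∁ VY) _ x∈
                      (x∈H , x∈∁VY) = x∈p∩q⁻ H (∁ VY) x∈H∩∁VY
                      κ⁺x≡ = trans (cong (join k m) (χ-∉ (x∈∁p⇒x∉p x∈∁VY)))
                                   (cong (_↑ˡ m) (∈-colorClass⁻ κ x∈C))
                  in  x∈p∩q⁺ (x∈H , ∈-colorClass⁺ κ⁺ κ⁺x≡))

        colorClass-↑ʳ : ∀ j → colorClass κ⁺ (k ↑ʳ j) ≡ ⁅ nth VY j ⁆
        colorClass-↑ʳ j = ⊆-antisym
          (λ x∈ → subst (_∈ ⁅ nth VY j ⁆) (sym (χ-inj₂ (join-injective k m (∈-colorClass⁻ κ⁺ x∈))))
                    (x∈⁅x⁆ (nth VY j)))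
          (λ x∈ → subst (_∈ colorClass κ⁺ (k ↑ʳ j)) (sym (x∈⁅y⁆⇒x≡y (nth VY j) x∈))
                    (∈-colorClass⁺ κ⁺ (cong (join k m) (χ-nth j))))

        count-↑ˡ : ∀ {A B} → X A → Y B → ∀ t → count κ⁺ (A ∪ B) (t ↑ˡ m) ≡ count κ A t
        count-↑ˡ XA YB t = cong ∣_∣ (trans (∩-colorClass-↑ˡ _ t)
                                        (cong (_∩ colorClass κ t) (Join-face-∩∁ XA YB)))

        ∑-count-↑ʳ : ∀ H H′ →
          sum (tabulate (λ j → count κ⁺ H (k ↑ʳ j) ⊓ count κ⁺ H′ (k ↑ʳ j))) ≡ ∣ (H ∩ H′) ∩ VY ∣
        ∑-count-↑ʳ H H′ = trans
          (cong sum (tabulate-cong λ j →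
            trans (cong (λ C → ∣ H ∩ C ∣ ⊓ ∣ H′ ∩ C ∣) (colorClass-↑ʳ j))
                  (∣p∩⁅x⁆∣⊓∣q∩⁅x⁆∣ H H′ (nth VY j))))
          (sym (∣p∩q∣≡∑∣p∩⁅nth⁆∣ (H ∩ H′) VY))

      Join-linear : IsLinearColoring X k κ → IsLinearColoring (Join X Y) (k + m) κ⁺
      Join-linear (surjective , linear) = surjective⁺ , linear⁺
        where
        surjective⊎ : ∀ c → ∃ λ v → Vert (Join X Y) v × χ v ≡ c
        surjective⊎ (inj₁ t) =
          let (v , Xv , κv≡t) = surjective t
          in  v , Join-Vertˡ Y∅ Xv , trans (χ-∉ (Vert-∉VY Xv)) (cong inj₁ κv≡t)
        surjective⊎ (inj₂ j) = nth VY j , Join-Vertʳ X∅ (∈-vertices⁻ Y? (nth-∈ VY j)) , χ-nth j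

        surjective⁺ : ∀ t → ∃ λ v → Vert (Join X Y) v × κ⁺ v ≡ t
        surjective⁺ t =
          let (v , Jv , χv≡) = surjective⊎ (splitAt k t)
          in  v , Jv , trans (cong (join k m) χv≡) (join-splitAt k m t)

        linear⁺ : ∀ H H′ → IsFacet (Join X Y) H → IsFacet (Join X Y) H′ →
          sum (tabulate (λ t → count κ⁺ H t ⊓ count κ⁺ H′ t)) ≡ ∣ H ∩ H′ ∣
        linear⁺ H H′ facetH facetH′
          with IsFacet-Join⁻ X-closed Y-closed disjoint facetH
             | IsFacet-Join⁻ X-closed Y-closed disjoint facetH′
        ... | A , B , facetA , YB , refl | A′ , B′ , facetA′ , YB′ , refl = begin
          sum (tabulate (λ t → count κ⁺ H t ⊓ count κ⁺ H′ t))
            ≡⟨ sum-tabulate-↑ k _ ⟩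
          sum (tabulate (λ t → count κ⁺ H (t ↑ˡ m) ⊓ count κ⁺ H′ (t ↑ˡ m)))
            + sum (tabulate (λ j → count κ⁺ H (k ↑ʳ j) ⊓ count κ⁺ H′ (k ↑ʳ j)))
            ≡⟨ cong₂ _+_ ∑-count-↑ˡ (∑-count-↑ʳ H H′) ⟩
          ∣ A ∩ A′ ∣ + ∣ (H ∩ H′) ∩ VY ∣
            ≡⟨ cong (λ S → ∣ S ∣ + ∣ (H ∩ H′) ∩ VY ∣) A∩A′≡ ⟩
          ∣ (H ∩ H′) ∩ ∁ VY ∣ + ∣ (H ∩ H′) ∩ VY ∣
            ≡⟨ ∣p∣≡∣p∩∁q∣+∣p∩q∣ (H ∩ H′) VY ⟨
          ∣ H ∩ H′ ∣ ∎
          where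
          open ≡-Reasoning
          ∑-count-↑ˡ : sum (tabulate (λ t → count κ⁺ H (t ↑ˡ m) ⊓ count κ⁺ H′ (t ↑ˡ m))) ≡ ∣ A ∩ A′ ∣
          ∑-count-↑ˡ = trans
            (cong sum (tabulate-cong λ t →
              cong₂ _⊓_ (count-↑ˡ (proj₁ facetA) YB t) (count-↑ˡ (proj₁ facetA′) YB′ t)))
            (linear A A′ facetA facetA′)
          A∩A′≡ : A ∩ A′ ≡ (H ∩ H′) ∩ ∁ VY
          A∩A′≡ = trans (sym (cong₂ _∩_ (Join-face-∩∁ (proj₁ facetA) YB)
                                        (Join-face-∩∁ (proj₁ facetA′) YB′)))
                        (sym (∩-∁-distrib H H′ VY))

      Join-representative : ∀ {X₁} → IsRepresentative X k κ X₁ →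
        IsRepresentative (Join X Y) (k + m) κ⁺ (Join X₁ Y)
      Join-representative {X₁} (W , W-vert , W-unique , W-facet , X₁⊆ , ⊆X₁) =
        W ∪ VY , vert⁺ , unique⁺ , facet⁺ , X₁Y⊆ , ⊆X₁Y
        where
        vert⁺ : ∀ v → v ∈ W ∪ VY → Vert (Join X Y) v
        vert⁺ v v∈ = Sum.[ Join-Vertˡ Y∅ ∘ W-vert v , Join-Vertʳ X∅ ∘ ∈-vertices⁻ Y? ] (x∈p∪q⁻ W VY v∈)

        unique⊎ : ∀ c → ∃ λ v → v ∈ W ∪ VY × χ v ≡ c × (∀ u → u ∈ W ∪ VY → χ u ≡ c → u ≡ v)
        unique⊎ (inj₁ t) =
          let (v , v∈W , κv≡t , unique) = W-unique t
          in  v , p⊆p∪q VY v∈W , trans (χ-∉ (Vert-∉VY (W-vert v v∈W))) (cong inj₁ κv≡t) ,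
              λ u u∈ χu≡ → let (u∉VY , κu≡t) = χ-inj₁ χu≡
                           in  unique u (x∈p∪q∧x∉q⇒x∈p u∈ u∉VY) κu≡t
        unique⊎ (inj₂ j) = nth VY j , q⊆p∪q W VY (nth-∈ VY j) , χ-nth j , λ u _ → χ-inj₂

        unique⁺ : ∀ t → ∃ λ v → v ∈ W ∪ VY × κ⁺ v ≡ t × (∀ u → u ∈ W ∪ VY → κ⁺ u ≡ t → u ≡ v)
        unique⁺ t =
          let (v , v∈ , χv≡ , unique) = unique⊎ (splitAt k t)
          in  v , v∈ , trans (cong (join k m) χv≡) (join-splitAt k m t) ,
              λ u u∈ κ⁺u≡t → unique u u∈ (join-injective k m (trans κ⁺u≡t (sym (join-splitAt k m t))))

        facet⁺ : ∀ x y → Vert (Join X Y) x → y ∈ W ∪ VY → κ⁺ x ≡ κ⁺ y →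
          ∀ H → IsFacet (Join X Y) H → x ∈ H → y ∈ H
        facet⁺ x y _ y∈ κ⁺x≡κ⁺y H facetH x∈H with χ x in χx≡ | join-injective k m {χ x} {χ y} κ⁺x≡κ⁺y
        ... | inj₂ j | χx≡χy = subst (_∈ H) (trans (χ-inj₂ χx≡) (sym (χ-inj₂ (sym χx≡χy)))) x∈H
        ... | inj₁ t | χx≡χy with IsFacet-Join⁻ X-closed Y-closed disjoint facetH
        ... | A , B , facetA , YB , refl =
          let (x∉VY , κx≡t) = χ-inj₁ χx≡
              (y∉VY , κy≡t) = χ-inj₁ (sym χx≡χy)
              x∈A = Join-face-∉VY (proj₁ facetA) YB x∈H x∉VY
          in  p⊆p∪q B (W-facet x y (∈-face⇒Vert X-closed (proj₁ facetA) x∈A)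
                         (x∈p∪q∧x∉q⇒x∈p y∈ y∉VY) (trans κx≡t (sym κy≡t)) A facetA x∈A)

        X₁Y⊆ : ∀ {S} → Join X₁ Y S → Join X Y S × S ⊆ W ∪ VY
        X₁Y⊆ (A , B , X₁A , YB , refl) =
          let (XA , A⊆W) = X₁⊆ X₁A
          in  (A , B , XA , YB , refl) , x∈p∪q⁺ ∘ Sum.map A⊆W (face⊆VY YB) ∘ x∈p∪q⁻ A B

        ⊆X₁Y : ∀ {S} → Join X Y S × S ⊆ W ∪ VY → Join X₁ Y S
        ⊆X₁Y ((A , B , XA , YB , refl) , A∪B⊆) =
          A , B , ⊆X₁ (XA , λ x∈A → x∈p∪q∧x∉q⇒x∈p (A∪B⊆ (p⊆p∪q B x∈A)) (face-∉VY XA x∈A)) , YB , refl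

    LCStep-Join : ∀ {X₁} → LCStep X X₁ → LCStep (Join X Y) (Join X₁ Y)
    LCStep-Join (k , κ , linear , representative) =
      k + m , κ⁺ κ , Join-linear κ linear , Join-representative κ representative

  LCReduces-Join : ∀ {X X₂} → DownClosed X → X ⊥ → DisjointVerts X Y →
    LCReduces X X₂ → LCReduces (Join X Y) (Join X₂ Y)
  LCReduces-Join _ _ _ (done X≐X₂) = done (Join-congˡ X≐X₂)
  LCReduces-Join X-closed X∅ disjoint (step X₁ s@(_ , _ , _ , rep) X₁↝X₂) =
    step (Join X₁ Y) (LCStep-Join X-closed X∅ disjoint s)
      (LCReduces-Join (representative-closed rep X-closed) (representative-∅ rep X∅)
        (DisjointVerts-⊑ {Y = Y} (representative-⊑ rep) disjoint) X₁↝X₂)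

proposition5p9 : ∀ (n : ℕ) (X₁ X₂ Y : Cx n) →
    IsComplex X₁ → IsComplex X₂ → IsComplex Y →
    X₂ ⊑ X₁ → DisjointVerts X₁ Y →
    LCReduces X₁ X₂ → LCReduces (Join X₁ Y) (Join X₂ Y)
proposition5p9 n X₁ X₂ Y (X₁? , X₁-closed) (_ , X₂-closed) (Y? , Y-closed) X₂⊑X₁ disjoint X₁↝X₂
  with X₁? ⊥ ×-dec Y? ⊥
... | yes (X₁∅ , Y∅) = LCReduces-Join Y? Y-closed Y∅ X₁-closed X₁∅ disjoint X₁↝X₂
... | no ¬∅ = done (empty-≐ (¬∅ ∘ Join-∅ X₁-closed Y-closed)
                            (¬∅ ∘ map₁ (X₂⊑X₁ ⊥) ∘ Join-∅ X₂-closed Y-closed))
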